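{- Let $\mathcal{M}=\langle\mathfrak{F}, \mathrm{Val}\rangle$ be an Ł$_n$-valued $\mathcal{L}$-model based on the $\mathcal{L}$-frame $\mathfrak{F}$. For any world $u$ of $\mathfrak{C}e_n(\mathcal{M})$ and any $\phi \in \mathsf{Form}_\mathcal{L}$ we have $\mathrm{Val}^e(u, \phi)=u(\mathrm{Val}(-, \phi))$.
   Context: $\mathcal{L}=\{\neg,\rightarrow,1\}\cup\{\nabla_i\mid i\in I\}$ is a modal language where each $\nabla_i$ is a $k_i$-ary modality; $\mathsf{Form}_\mathcal{L}$ is the set of formulas over an infinite set $\mathsf{Prop}$ of variables. Ł$_n=\{0,\frac1n,\dots,1\}$ is the subalgebra of the standard MV-algebra $[0,1]$ with $x\rightarrow y=\min(1,1-x+y)$, $\neg x=1-x$. An $\mathcal{L}$-frame is $\mathfrak{F}=\langle W,(R_i)_{i\in I}\rangle$ with $R_i$ a $(k_i+1)$-ary relation; write $\mathbf{w}\in R_iu$ for $(u,w_1,\dots,w_{k_i})\in R_i$. An Ł$_n$-valued $\mathcal{L}$-model is $\langle\mathfrak{F},\mathrm{Val}\rangle$ with $\mathrm{Val}\colon W\times\mathsf{Prop}\to$ Ł$_n$, extended to all formulas using the Łukasiewicz interpretation of $0,\neg,\rightarrow$ and $\mathrm{Val}(u,\nabla(\boldsymbol{\phi}))=\min\{\max_{1\le\ell\le k}\mathrm{Val}(w_\ell,\phi_\ell)\mid \mathbf{w}\in Ru\}$. $\mathrm{Val}(-,\phi)$ denotes the map $W\to$ Ł$_n$, $w\mapsto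 \mathrm{Val}(w,\phi)$. The Ł$_n$-complex algebra $\mathfrak{F}_{+_n}$ is Ł$_n^W$ with $\neg,\rightarrow,1$ computed pointwise and $\nabla_i\boldsymbol{\alpha}(u)=\min\{\max_{\ell}\alpha_\ell(v_\ell)\mid \mathbf{v}\in R_iu\}$. The canonical extension $\mathfrak{C}e(\mathfrak{F})$ is (up to the isomorphism $u\mapsto u|_{B(\mathfrak{F}_{+_n})}$ with the canonical frame of the Boolean algebra $B(\mathfrak{F}_{+_n})$ of idempotents, i.e. the ultrafilter extension) the $\mathcal{L}$-frame whose worlds are the MV-algebra homomorphisms $u\colon\mathfrak{F}_{+_n}\to$ Ł$_n$, with $uR_i\mathbf{v}$ iff for all $\mathbf{a}\in\mathfrak{F}_{+_n}^{k_i}$, $u(\nabla_i\mathbf{a})=1$ implies $\max_\ell v_\ell(a_\ell)=1$. The $\mathcal{L}_n$-canonical extension of $\mathcal{M}$ is $\mathfrak{C}e_n(\mathcal{M})=\langle\mathfrak{C}e(\mathfrak{F}),\mathrm{Val}^e\rangle$ with $\mathrm{Val}^e(u,p)=u(\mathrm{Val}(-,p))$ for $p\in\mathsf{Prop}$. -}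

module Defs where

open import Data.Nat using (ℕ; zero; suc; _∸_; _≤ᵇ_)
open import Data.Nat.Properties using (m∸n≤m; ≤-<-trans)
open import Data.Fin using (Fin; toℕ; fromℕ; fromℕ<; opposite) renaming (_≤_ to _≤F_)
open import Data.Fin.Properties using (toℕ<n)
open import Data.Bool using (Bool; true; false; _∧_; not; if_then_else_)
open import Data.Product using (Σ; _×_)
open import Data.Sum using (_⊎_)
open import Relation.Nullary using (¬_; Dec)
open import Relation.Binary.PropositionalEquality using (_≡_)

-- The MV-chain Ł_n = {0, 1/n, ..., 1}; the element k : Fin (suc n)
-- represents the rational k/n.

Ł : ℕ → Set
Ł n = Fin (suc n)

module _ {n : ℕ} where

  ⊤Ł : Ł n
  ⊤Ł = fromℕ n

  ⊥Ł : Ł n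
  ⊥Ł = Fin.zero

  ¬Ł : Ł n → Ł n
  ¬Ł = opposite

  _⊖_ : Ł n → Ł n → Ł n
  x ⊖ y = fromℕ< (≤-<-trans (m∸n≤m (toℕ x) (toℕ y)) (toℕ<n x))

  -- x → y = min(1, 1 - x + y) = 1 - max(0, x - y)
  _⇒Ł_ : Ł n → Ł n → Ł n
  x ⇒Ł y = opposite (x ⊖ y)

  _⊔Ł_ : Ł n → Ł n → Ł n
  x ⊔Ł y = if toℕ x ≤ᵇ toℕ y then y else x

  maxŁ : (k : ℕ) → (Fin k → Ł n) → Ł n
  maxŁ zero    f = ⊥Ł
  maxŁ (suc k) f = f Fin.zero ⊔Ł maxŁ k (λ i → f (Fin.suc i))

  -- x is the infimum (in the chain Ł_n) of { f s | P s }.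
  -- Since Ł_n is a finite chain this is the min of the paper
  -- (and equals 1 for the empty set).
  IsInf : {S : Set} → (S → Set) → (S → Ł n) → Ł n → Set
  IsInf {S} P f x =
    ((s : S) → P s → x ≤F f s) ×
    ((y : Ł n) → ((s : S) → P s → y ≤F f s) → y ≤F x)

data Form {I : Set} (ar : I → ℕ) : Set where
  var : ℕ → Form ar
  one : Form ar
  neg : Form ar → Form ar
  imp : Form ar → Form ar → Form ar
  nab : (i : I) → (Fin (ar i) → Form ar) → Form ar

-- L-frames: R i u ws  means  (u, ws 1, ..., ws k) ∈ R_i
record Frame {I : Set} (ar : I → ℕ) : Set₁ where
  field
    World : Set
    R     : (i : I) → World → (Fin (ar i) → World) → Set
open Frame public

record IsValuation {I : Set} {ar : I → ℕ} (n : ℕ) (F : Frame ar)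
    (V : World F → ℕ → Ł n) (S : Form ar → World F → Ł n) : Set where
  field
    sem-var : ∀ p w → S (var p) w ≡ V w p
    sem-one : ∀ w → S one w ≡ ⊤Ł
    sem-neg : ∀ φ w → S (neg φ) w ≡ ¬Ł (S φ w)
    sem-imp : ∀ φ ψ w → S (imp φ ψ) w ≡ (S φ w ⇒Ł S ψ w)
    sem-nab : ∀ i φs u →
      IsInf (R F i u) (λ ws → maxŁ (ar i) (λ ℓ → S (φs ℓ) (ws ℓ))) (S (nab i φs) u)

module _ {I : Set} {ar : I → ℕ} (n : ℕ) (F : Frame ar) where

  Cx : Set
  Cx = World F → Ł n

  IsNabla : (i : I) → (Fin (ar i) → Cx) → Cx → Set
  IsNabla i a b = ∀ u →
    IsInf (R F i u) (λ vs → maxŁ (ar i) (λ ℓ → a ℓ (vs ℓ))) (b u)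

  -- MV-algebra homomorphisms F_{+n} → Ł_n (preserving ¬, →, 1);
  -- elements of F_{+n} are functions, compared pointwise.
  record Hom : Set where
    field
      ap      : Cx → Ł n
      ap-cong : ∀ a b → (∀ w → a w ≡ b w) → ap a ≡ ap b
      ap-one  : ap (λ _ → ⊤Ł) ≡ ⊤Ł
      ap-neg  : ∀ a → ap (λ w → ¬Ł (a w)) ≡ ¬Ł (ap a)
      ap-imp  : ∀ a b → ap (λ w → a w ⇒Ł b w) ≡ (ap a ⇒Ł ap b)
  open Hom public

  CeR : (i : I) → Hom → (Fin (ar i) → Hom) → Set
  CeR i u vs = (a : Fin (ar i) → Cx) (b : Cx) → IsNabla i a b →
    ap u b ≡ ⊤Ł → maxŁ (ar i) (λ ℓ → ap (vs ℓ) (a ℓ)) ≡ ⊤Ł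

  Ce : Frame ar
  Ce = record { World = Hom ; R = CeR }

  Vale : (World F → ℕ → Ł n) → Hom → ℕ → Ł n
  Vale V u p = ap u (λ w → V w p)

-- Classical metatheory principles (true in ZFC, used by the paper implicitly)

LEM : Set₁
LEM = (P : Set) → Dec P

Subset : Set → Set
Subset W = W → Bool

module _ {W : Set} where
  fullS emptyS : Subset W
  fullS _ = true
  emptyS _ = false

  _∩S_ : Subset W → Subset W → Subset W
  (a ∩S b) w = a w ∧ b w

  complS : Subset W → Subset W
  complS a w = not (a w)

  _⊆S_ : Subset W → Subset W → Set
  a ⊆S b = ∀ w → a w ≡ true → b w ≡ true

  IsFilter : (Subset W → Set) → Set
  IsFilter 𝓕 = 𝓕 fullS × (∀ a b → 𝓕 a → 𝓕 b → 𝓕 (a ∩S b))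
               × (∀ a b → a ⊆S b → 𝓕 a → 𝓕 b)

  IsUltrafilter : (Subset W → Set) → Set
  IsUltrafilter 𝓤 = IsFilter 𝓤 × ¬ 𝓤 emptyS × (∀ a → 𝓤 a ⊎ 𝓤 (complS a))

UltrafilterLemma : Set₁
UltrafilterLemma = (W : Set) (𝓕 : Subset W → Set) → IsFilter 𝓕 → ¬ 𝓕 emptyS →
  Σ (Subset W → Set) (λ 𝓤 → IsUltrafilter 𝓤 × (∀ a → 𝓕 a → 𝓤 a))

-- Induction on φ; the propositional cases hold because u is an MV-homomorphism.
-- For φ = ∇ψ put a_ℓ = Val(-, ψ_ℓ), b = ∇a and t = u(b); it suffices that t is the infimum
-- of max_ℓ v_ℓ(a_ℓ) over the canonical successors v of u.  Homomorphisms into Ł_n fix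
-- constants, so they commute with the term operation z ↦ (t → z)ⁿ, the indicator of [t, 1];
-- applying it to b = ∇a reduces the lower bound to the Boolean condition defining the
-- canonical relation.  For t < 1, an ultrafilter of tuples of worlds below t (LEM and the
-- ultrafilter lemma) yields successors v with every v_ℓ(a_ℓ) ≤ t.

module Submission where

open import Defs
open import Data.Nat as ℕ using (ℕ; zero; suc; _∸_; _≤_; z≤n; s≤s)
open import Data.Nat.Properties as ℕ using (≤-refl; ≤-trans; ≤-antisym; n≤1+n; m∸n≤m; ≤-<-trans; <-≤-trans)
open import Data.Fin as Fin using (Fin; toℕ; fromℕ<) renaming (_≤_ to _≤F_)
open import Data.Fin.Properties using (toℕ-injective; toℕ-fromℕ; toℕ-fromℕ<; opposite-prop; toℕ≤pred[n]; toℕ<n; ¬∀⟶∃¬)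
open import Data.Bool using (Bool; true; false; _∧_; not; T)
open import Data.Unit using (tt)
open import Data.Product using (∃; _×_; _,_; proj₁; proj₂)
open import Data.Sum using (_⊎_; inj₁; inj₂)
open import Data.Empty using (⊥; ⊥-elim)
open import Function using (_∘_; const)
open import Relation.Nullary using (¬_; yes; no; does; contradiction)
open import Relation.Binary.PropositionalEquality

module _ {n : ℕ} where

  toℕ-⊤Ł : toℕ (⊤Ł {n}) ≡ n
  toℕ-⊤Ł = toℕ-fromℕ n

  toℕ-¬Ł : (x : Ł n) → toℕ (¬Ł x) ≡ n ∸ toℕ x
  toℕ-¬Ł = opposite-prop

  toℕ-⇒Ł : (x y : Ł n) → toℕ (x ⇒Ł y) ≡ n ∸ (toℕ x ∸ toℕ y)
  toℕ-⇒Ł x y = trans (opposite-prop (x ⊖ y))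
    (cong (n ∸_) (toℕ-fromℕ< (≤-<-trans (m∸n≤m (toℕ x) (toℕ y)) (toℕ<n x))))

  toℕ≤n : (x : Ł n) → toℕ x ℕ.≤ n
  toℕ≤n = toℕ≤pred[n]

  ≤⊤Ł : (x : Ł n) → x ≤F ⊤Ł
  ≤⊤Ł x = subst (toℕ x ℕ.≤_) (sym toℕ-⊤Ł) (toℕ≤n x)

  ≤-antisymŁ : {x y : Ł n} → x ≤F y → y ≤F x → x ≡ y
  ≤-antisymŁ p q = toℕ-injective (≤-antisym p q)

  ⊤Ł≤⇒≡⊤Ł : {x : Ł n} → ⊤Ł ≤F x → x ≡ ⊤Ł
  ⊤Ł≤⇒≡⊤Ł {x} p = ≤-antisymŁ (≤⊤Ł x) p

  toℕ≡n⇒≡⊤Ł : {x : Ł n} → toℕ x ≡ n → x ≡ ⊤Ł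
  toℕ≡n⇒≡⊤Ł e = toℕ-injective (trans e (sym toℕ-⊤Ł))

  ¬Ł-⊤Ł : ¬Ł (⊤Ł {n}) ≡ ⊥Ł
  ¬Ł-⊤Ł = toℕ-injective (trans (toℕ-¬Ł ⊤Ł) (trans (cong (n ∸_) toℕ-⊤Ł) (ℕ.n∸n≡0 n)))

  0<toℕ⊤Ł : 1 ℕ.≤ n → 0 ℕ.< toℕ (⊤Ł {n})
  0<toℕ⊤Ł = subst (1 ℕ.≤_) (sym toℕ-⊤Ł)

  ⊤Ł≢⊥Ł : 1 ℕ.≤ n → ⊤Ł {n} ≢ ⊥Ł
  ⊤Ł≢⊥Ł 1≤n e = ℕ.<-irrefl refl (subst (λ x → 0 ℕ.< toℕ x) e (0<toℕ⊤Ł 1≤n))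

  ≤⇒⇒Ł≡⊤Ł : {x y : Ł n} → x ≤F y → (x ⇒Ł y) ≡ ⊤Ł
  ≤⇒⇒Ł≡⊤Ł {x} {y} x≤y = toℕ≡n⇒≡⊤Ł (trans (toℕ-⇒Ł x y) (cong (n ∸_) (ℕ.m≤n⇒m∸n≡0 x≤y)))

  ⇒Ł≡⊤Ł⇒≤ : {x y : Ł n} → (x ⇒Ł y) ≡ ⊤Ł → x ≤F y
  ⇒Ł≡⊤Ł⇒≤ {x} {y} e = ℕ.m∸n≡0⇒m≤n (ℕ.∸-cancelˡ-≡ (≤-trans (m∸n≤m (toℕ x) (toℕ y)) (toℕ≤n x)) z≤n
    (trans (sym (toℕ-⇒Ł x y)) (trans (cong toℕ e) toℕ-⊤Ł)))

  _⊙_ : Ł n → Ł n → Ł n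
  x ⊙ y = ¬Ł (x ⇒Ł ¬Ł y)

  pow : ℕ → Ł n → Ł n
  pow zero    x = ⊤Ł
  pow (suc m) x = x ⊙ pow m x

  toℕ-⊙ : (x y : Ł n) → toℕ (x ⊙ y) ≡ toℕ x ∸ (n ∸ toℕ y)
  toℕ-⊙ x y = begin
    toℕ (x ⊙ y)                         ≡⟨ toℕ-¬Ł (x ⇒Ł ¬Ł y) ⟩
    n ∸ toℕ (x ⇒Ł ¬Ł y)                 ≡⟨ cong (n ∸_) (toℕ-⇒Ł x (¬Ł y)) ⟩
    n ∸ (n ∸ (toℕ x ∸ toℕ (¬Ł y)))      ≡⟨ ℕ.m∸[m∸n]≡n (≤-trans (m∸n≤m (toℕ x) (toℕ (¬Ł y))) (toℕ≤n x)) ⟩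
    toℕ x ∸ toℕ (¬Ł y)                  ≡⟨ cong (toℕ x ∸_) (toℕ-¬Ł y) ⟩
    toℕ x ∸ (n ∸ toℕ y)                 ∎
    where open ≡-Reasoning

  ⊥Ł-⊙ : (y : Ł n) → ⊥Ł ⊙ y ≡ ⊥Ł
  ⊥Ł-⊙ y = toℕ-injective (trans (toℕ-⊙ ⊥Ł y) (ℕ.0∸n≡0 (n ∸ toℕ y)))

  ⊙-⊥Ł : (x : Ł n) → x ⊙ ⊥Ł ≡ ⊥Ł
  ⊙-⊥Ł x = toℕ-injective (trans (toℕ-⊙ x ⊥Ł) (ℕ.m≤n⇒m∸n≡0 (toℕ≤n x)))

  pow-⊤Ł : (m : ℕ) → pow m ⊤Ł ≡ ⊤Ł
  pow-⊤Ł zero    = refl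
  pow-⊤Ł (suc m) = toℕ≡n⇒≡⊤Ł (begin
    toℕ (⊤Ł ⊙ pow m ⊤Ł)            ≡⟨ toℕ-⊙ ⊤Ł (pow m ⊤Ł) ⟩
    toℕ ⊤Ł ∸ (n ∸ toℕ (pow m ⊤Ł))  ≡⟨ cong₂ (λ p q → p ∸ (n ∸ q)) toℕ-⊤Ł (trans (cong toℕ (pow-⊤Ł m)) toℕ-⊤Ł) ⟩
    n ∸ (n ∸ n)                    ≡⟨ cong (n ∸_) (ℕ.n∸n≡0 n) ⟩
    n                              ∎)
    where open ≡-Reasoning

  -- Each factor x < 1 lowers the value by at least 1/n.
  toℕ-pow≤ : (x : Ł n) → toℕ x ℕ.< n → (m : ℕ) → m ℕ.≤ n → toℕ (pow m x) ℕ.≤ n ∸ m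
  toℕ-pow≤ x x<n zero    _    = toℕ≤n ⊤Ł
  toℕ-pow≤ x x<n (suc m) m<n = begin
    toℕ (x ⊙ pow m x)                ≡⟨ toℕ-⊙ x (pow m x) ⟩
    toℕ x ∸ (n ∸ toℕ (pow m x))      ≤⟨ ℕ.∸-mono (ℕ.<⇒≤pred x<n) (ℕ.∸-monoʳ-≤ n (toℕ-pow≤ x x<n m m≤n)) ⟩
    ℕ.pred n ∸ (n ∸ (n ∸ m))         ≡⟨ cong (ℕ.pred n ∸_) (ℕ.m∸[m∸n]≡n m≤n) ⟩
    ℕ.pred n ∸ m                     ≡⟨ ℕ.∸-+-assoc n 1 m ⟩
    n ∸ suc m                        ∎
    where
      open ℕ.≤-Reasoning
      m≤n = ≤-trans (n≤1+n m) m<n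

  pow-n-≢⊤Ł : {x : Ł n} → x ≢ ⊤Ł → pow n x ≡ ⊥Ł
  pow-n-≢⊤Ł {x} x≢⊤ = toℕ-injective (ℕ.n≤0⇒n≡0
    (subst (toℕ (pow n x) ℕ.≤_) (ℕ.n∸n≡0 n) (toℕ-pow≤ x x<n n ≤-refl)))
    where
      x<n : toℕ x ℕ.< n
      x<n with ℕ.m≤n⇒m<n∨m≡n (toℕ≤n x)
      ... | inj₁ x<n = x<n
      ... | inj₂ x≡n = ⊥-elim (x≢⊤ (toℕ≡n⇒≡⊤Ł x≡n))

  -- pow n is the indicator of {1}, so threshold t is the indicator of [t, 1] written as a term.
  threshold : Ł n → Ł n → Ł n
  threshold t z = pow n (t ⇒Ł z)

  threshold-≤ : {t z : Ł n} → t ≤F z → threshold t z ≡ ⊤Ł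
  threshold-≤ t≤z = trans (cong (pow n) (≤⇒⇒Ł≡⊤Ł t≤z)) (pow-⊤Ł n)

  threshold-≰ : {t z : Ł n} → ¬ t ≤F z → threshold t z ≡ ⊥Ł
  threshold-≰ t≰z = pow-n-≢⊤Ł (λ e → t≰z (⇒Ł≡⊤Ł⇒≤ e))

  threshold-pos : {t z : Ł n} → 0 ℕ.< toℕ (threshold t z) → t ≤F z
  threshold-pos {t} {z} pos with toℕ t ℕ.≤? toℕ z
  ... | yes t≤z = t≤z
  ... | no  t≰z = ⊥-elim (ℕ.<-irrefl refl (subst (λ q → 0 ℕ.< toℕ q) (threshold-≰ t≰z) pos))

  _⊕_ : Ł n → Ł n → Ł n
  x ⊕ y = ¬Ł x ⇒Ł y

  mul : ℕ → Ł n → Ł n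
  mul zero    x = ⊥Ł
  mul (suc m) x = x ⊕ mul m x

  toℕ-⊕ : (x y : Ł n) → toℕ (x ⊕ y) ≡ n ∸ ((n ∸ toℕ x) ∸ toℕ y)
  toℕ-⊕ x y = trans (toℕ-⇒Ł (¬Ł x) y) (cong (λ z → n ∸ (z ∸ toℕ y)) (toℕ-¬Ł x))

  ⊕-mono-≤ : {x x′ y y′ : Ł n} → x ≤F x′ → y ≤F y′ → (x ⊕ y) ≤F (x′ ⊕ y′)
  ⊕-mono-≤ {x} {x′} {y} {y′} x≤x′ y≤y′ = subst₂ ℕ._≤_ (sym (toℕ-⊕ x y)) (sym (toℕ-⊕ x′ y′))
    (ℕ.∸-monoʳ-≤ n (ℕ.∸-mono (ℕ.∸-monoʳ-≤ n x≤x′) y≤y′))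

  mul-mono-≤ : (m : ℕ) {x y : Ł n} → x ≤F y → mul m x ≤F mul m y
  mul-mono-≤ zero    x≤y = z≤n
  mul-mono-≤ (suc m) x≤y = ⊕-mono-≤ x≤y (mul-mono-≤ m x≤y)

  mul-⊥Ł : (m : ℕ) → mul m (⊥Ł {n}) ≡ ⊥Ł
  mul-⊥Ł zero    = refl
  mul-⊥Ł (suc m) = toℕ-injective (trans (toℕ-⊕ ⊥Ł (mul m ⊥Ł))
    (trans (cong (λ q → n ∸ (n ∸ toℕ q)) (mul-⊥Ł m)) (ℕ.n∸n≡0 n)))

  atom : 1 ℕ.≤ n → Ł n
  atom 1≤n = fromℕ< (s≤s 1≤n)

  toℕ-atom : (1≤n : 1 ℕ.≤ n) → toℕ (atom 1≤n) ≡ 1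
  toℕ-atom 1≤n = toℕ-fromℕ< (s≤s 1≤n)

  toℕ-mul-atom : (1≤n : 1 ℕ.≤ n) (m : ℕ) → m ℕ.≤ n → toℕ (mul m (atom 1≤n)) ≡ m
  toℕ-mul-atom 1≤n zero    _   = refl
  toℕ-mul-atom 1≤n (suc m) m<n = begin
    toℕ (ε ⊕ mul m ε)                       ≡⟨ toℕ-⊕ ε (mul m ε) ⟩
    n ∸ ((n ∸ toℕ ε) ∸ toℕ (mul m ε))       ≡⟨ cong₂ (λ p q → n ∸ ((n ∸ p) ∸ q)) (toℕ-atom 1≤n)
                                                 (toℕ-mul-atom 1≤n m (≤-trans (n≤1+n m) m<n)) ⟩
    n ∸ ((n ∸ 1) ∸ m)                       ≡⟨ cong (n ∸_) (ℕ.∸-+-assoc n 1 m) ⟩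
    n ∸ (n ∸ suc m)                         ≡⟨ ℕ.m∸[m∸n]≡n m<n ⟩
    suc m                                   ∎
    where
      open ≡-Reasoning
      ε = atom 1≤n

  mul-atom-toℕ : (1≤n : 1 ℕ.≤ n) (x : Ł n) → mul (toℕ x) (atom 1≤n) ≡ x
  mul-atom-toℕ 1≤n x = toℕ-injective (toℕ-mul-atom 1≤n (toℕ x) (toℕ≤n x))

  ⊔Ł-sel : (x y : Ł n) → (x ⊔Ł y ≡ x × y ≤F x) ⊎ (x ⊔Ł y ≡ y × x ≤F y)
  ⊔Ł-sel x y with toℕ x ℕ.≤ᵇ toℕ y in e
  ... | true  = inj₂ (refl , ℕ.≤ᵇ⇒≤ (toℕ x) (toℕ y) (subst T (sym e) tt))
  ... | false = inj₁ (refl , ℕ.≮⇒≥ (λ x<y → subst T e (ℕ.≤⇒≤ᵇ (ℕ.<⇒≤ x<y))))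

  x≤x⊔Ły : (x y : Ł n) → x ≤F (x ⊔Ł y)
  x≤x⊔Ły x y with ⊔Ł-sel x y
  ... | inj₁ (e , _)   rewrite e = ≤-refl
  ... | inj₂ (e , x≤y) rewrite e = x≤y

  y≤x⊔Ły : (x y : Ł n) → y ≤F (x ⊔Ł y)
  y≤x⊔Ły x y with ⊔Ł-sel x y
  ... | inj₁ (e , y≤x) rewrite e = y≤x
  ... | inj₂ (e , _)   rewrite e = ≤-refl

  ⊔Ł-lub : {x y z : Ł n} → x ≤F z → y ≤F z → (x ⊔Ł y) ≤F z
  ⊔Ł-lub {x} {y} x≤z y≤z with ⊔Ł-sel x y
  ... | inj₁ (e , _) rewrite e = x≤z
  ... | inj₂ (e , _) rewrite e = y≤z

  maxŁ-ub : (k : ℕ) (g : Fin k → Ł n) (ℓ : Fin k) → g ℓ ≤F maxŁ k g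
  maxŁ-ub (suc k) g Fin.zero    = x≤x⊔Ły (g Fin.zero) _
  maxŁ-ub (suc k) g (Fin.suc ℓ) = ≤-trans (maxŁ-ub k (g ∘ Fin.suc) ℓ) (y≤x⊔Ły (g Fin.zero) _)

  maxŁ-lub : (k : ℕ) (g : Fin k → Ł n) {z : Ł n} → (∀ ℓ → g ℓ ≤F z) → maxŁ k g ≤F z
  maxŁ-lub zero    g h = z≤n
  maxŁ-lub (suc k) g h = ⊔Ł-lub (h Fin.zero) (maxŁ-lub k (g ∘ Fin.suc) (h ∘ Fin.suc))

  maxŁ-≥-witness : (k : ℕ) (g : Fin k → Ł n) {z : Ł n} → 0 ℕ.< toℕ z → z ≤F maxŁ k g → ∃ λ ℓ → z ≤F g ℓ
  maxŁ-≥-witness zero    g pos z≤0 = ⊥-elim (ℕ.<-irrefl refl (<-≤-trans pos z≤0))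
  maxŁ-≥-witness (suc k) g {z} pos z≤max with ⊔Ł-sel (g Fin.zero) (maxŁ k (g ∘ Fin.suc))
  ... | inj₁ (e , _) = Fin.zero , subst (z ≤F_) e z≤max
  ... | inj₂ (e , _) with maxŁ-≥-witness k (g ∘ Fin.suc) pos (subst (z ≤F_) e z≤max)
  ...   | ℓ , z≤gℓ = Fin.suc ℓ , z≤gℓ

  maxŁ-cong : (k : ℕ) {g h : Fin k → Ł n} → (∀ ℓ → g ℓ ≡ h ℓ) → maxŁ k g ≡ maxŁ k h
  maxŁ-cong zero    e = refl
  maxŁ-cong (suc k) e = cong₂ _⊔Ł_ (e Fin.zero) (maxŁ-cong k (e ∘ Fin.suc))

  IsInf-unique : {S : Set} {P : S → Set} {f : S → Ł n} {x y : Ł n} → IsInf P f x → IsInf P f y → x ≡ y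
  IsInf-unique {x = x} {y} (x-lb , x-glb) (y-lb , y-glb) = ≤-antisymŁ (y-glb x x-lb) (x-glb y y-lb)

  IsInf-cong : {S : Set} {P : S → Set} {f g : S → Ł n} {x : Ł n} → (∀ s → f s ≡ g s) → IsInf P f x → IsInf P g x
  IsInf-cong {x = x} f≗g (lb , glb) =
    (λ s p → subst (x ≤F_) (f≗g s) (lb s p)) ,
    (λ y y-lb → glb y (λ s p → subst (y ≤F_) (sym (f≗g s)) (y-lb s p)))

module HomProperties {I : Set} {ar : I → ℕ} {n : ℕ} {F : Frame ar} (h : Hom n F) where

  ap-⊥Ł : ap h (const ⊥Ł) ≡ ⊥Ł
  ap-⊥Ł = begin
    ap h (const ⊥Ł)          ≡⟨ ap-cong h _ _ (λ _ → sym ¬Ł-⊤Ł) ⟩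
    ap h (λ _ → ¬Ł ⊤Ł)       ≡⟨ ap-neg h (const ⊤Ł) ⟩
    ¬Ł (ap h (const ⊤Ł))     ≡⟨ cong ¬Ł (ap-one h) ⟩
    ¬Ł ⊤Ł                    ≡⟨ ¬Ł-⊤Ł ⟩
    ⊥Ł                       ∎
    where open ≡-Reasoning

  ap-⊙ : (a b : Cx n F) → ap h (λ w → a w ⊙ b w) ≡ ap h a ⊙ ap h b
  ap-⊙ a b = trans (ap-neg h (λ w → a w ⇒Ł ¬Ł (b w)))
    (cong ¬Ł (trans (ap-imp h a (¬Ł ∘ b)) (cong (ap h a ⇒Ł_) (ap-neg h b))))

  ap-⊕ : (a b : Cx n F) → ap h (λ w → a w ⊕ b w) ≡ ap h a ⊕ ap h b
  ap-⊕ a b = trans (ap-imp h (¬Ł ∘ a) b) (cong (_⇒Ł ap h b) (ap-neg h a))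

  ap-pow : (m : ℕ) (a : Cx n F) → ap h (pow m ∘ a) ≡ pow m (ap h a)
  ap-pow zero    a = ap-one h
  ap-pow (suc m) a = trans (ap-⊙ a (pow m ∘ a)) (cong (ap h a ⊙_) (ap-pow m a))

  ap-mul : (m : ℕ) (a : Cx n F) → ap h (mul m ∘ a) ≡ mul m (ap h a)
  ap-mul zero    a = ap-⊥Ł
  ap-mul (suc m) a = trans (ap-⊕ a (mul m ∘ a)) (cong (ap h a ⊕_) (ap-mul m a))

  ap-≤ : {a b : Cx n F} → (∀ w → a w ≤F b w) → ap h a ≤F ap h b
  ap-≤ {a} {b} a≤b = ⇒Ł≡⊤Ł⇒≤ (begin
    ap h a ⇒Ł ap h b          ≡⟨ ap-imp h a b ⟨
    ap h (λ w → a w ⇒Ł b w)   ≡⟨ ap-cong h _ _ (λ w → ≤⇒⇒Ł≡⊤Ł (a≤b w)) ⟩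
    ap h (const ⊤Ł)           ≡⟨ ap-one h ⟩
    ⊤Ł                        ∎)
    where open ≡-Reasoning

  -- e = h(1/n) satisfies n·e = 1 and ¬e = (n−1)·e, which forces e = 1/n.
  ap-atom : (1≤n : 1 ℕ.≤ n) → ap h (const (atom 1≤n)) ≡ atom 1≤n
  ap-atom 1≤n = ≤-antisymŁ e≤ε ε≤e
    where
      ε = atom 1≤n
      e = ap h (const ε)

      ne≡⊤ : mul n e ≡ ⊤Ł
      ne≡⊤ = begin
        mul n e                 ≡⟨ ap-mul n (const ε) ⟨
        ap h (const (mul n ε))  ≡⟨ ap-cong h _ _ (λ _ → toℕ≡n⇒≡⊤Ł (toℕ-mul-atom 1≤n n ≤-refl)) ⟩
        ap h (const ⊤Ł)         ≡⟨ ap-one h ⟩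
        ⊤Ł                      ∎
        where open ≡-Reasoning

      e≢0 : toℕ e ≢ 0
      e≢0 e≡0 = ⊤Ł≢⊥Ł 1≤n (begin
        ⊤Ł         ≡⟨ ne≡⊤ ⟨
        mul n e    ≡⟨ cong (mul n) (toℕ-injective e≡0) ⟩
        mul n ⊥Ł   ≡⟨ mul-⊥Ł n ⟩
        ⊥Ł         ∎)
        where open ≡-Reasoning

      ¬e≡[n-1]e : ¬Ł e ≡ mul (n ∸ 1) e
      ¬e≡[n-1]e = begin
        ¬Ł e                          ≡⟨ ap-neg h (const ε) ⟨
        ap h (const (¬Ł ε))           ≡⟨ ap-cong h _ _ (λ _ → toℕ-injective ¬ε≡[n-1]ε) ⟩
        ap h (const (mul (n ∸ 1) ε))  ≡⟨ ap-mul (n ∸ 1) (const ε) ⟩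
        mul (n ∸ 1) e                 ∎
        where
          open ≡-Reasoning
          ¬ε≡[n-1]ε : toℕ (¬Ł ε) ≡ toℕ (mul (n ∸ 1) ε)
          ¬ε≡[n-1]ε = trans (toℕ-¬Ł ε) (trans (cong (n ∸_) (toℕ-atom 1≤n))
                        (sym (toℕ-mul-atom 1≤n (n ∸ 1) (ℕ.m∸n≤m n 1))))

      ε≤e : ε ≤F e
      ε≤e = subst (ℕ._≤ toℕ e) (sym (toℕ-atom 1≤n)) (ℕ.n≢0⇒n>0 e≢0)

      n-1≤n-e : n ∸ 1 ℕ.≤ n ∸ toℕ e
      n-1≤n-e = begin
        n ∸ 1                    ≡⟨ toℕ-mul-atom 1≤n (n ∸ 1) (ℕ.m∸n≤m n 1) ⟨
        toℕ (mul (n ∸ 1) ε)      ≤⟨ mul-mono-≤ (n ∸ 1) ε≤e ⟩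
        toℕ (mul (n ∸ 1) e)      ≡⟨ cong toℕ ¬e≡[n-1]e ⟨
        toℕ (¬Ł e)               ≡⟨ toℕ-¬Ł e ⟩
        n ∸ toℕ e                ∎
        where open ℕ.≤-Reasoning

      e≤ε : e ≤F ε
      e≤ε = subst (toℕ e ℕ.≤_) (sym (toℕ-atom 1≤n))
        (ℕ.≮⇒≥ (λ 1<e → ℕ.<⇒≱ (ℕ.∸-monoʳ-< 1<e (toℕ≤n e)) n-1≤n-e))

  ap-const : 1 ℕ.≤ n → (x : Ł n) → ap h (const x) ≡ x
  ap-const 1≤n x = begin
    ap h (const x)                         ≡⟨ ap-cong h _ _ (λ _ → sym (mul-atom-toℕ 1≤n x)) ⟩
    ap h (const (mul (toℕ x) ε))           ≡⟨ ap-mul (toℕ x) (const ε) ⟩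
    mul (toℕ x) (ap h (const ε))           ≡⟨ cong (mul (toℕ x)) (ap-atom 1≤n) ⟩
    mul (toℕ x) ε                          ≡⟨ mul-atom-toℕ 1≤n x ⟩
    x                                      ∎
    where
      open ≡-Reasoning
      ε = atom 1≤n

  ap-threshold : 1 ℕ.≤ n → (t : Ł n) (a : Cx n F) → ap h (threshold t ∘ a) ≡ threshold t (ap h a)
  ap-threshold 1≤n t a = begin
    ap h (λ w → pow n (t ⇒Ł a w))     ≡⟨ ap-pow n (λ w → t ⇒Ł a w) ⟩
    pow n (ap h (λ w → t ⇒Ł a w))     ≡⟨ cong (pow n) (ap-imp h (const t) a) ⟩
    pow n (ap h (const t) ⇒Ł ap h a)  ≡⟨ cong (λ s → pow n (s ⇒Ł ap h a)) (ap-const 1≤n t) ⟩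
    pow n (t ⇒Ł ap h a)               ∎
    where open ≡-Reasoning

∧-true : {x y : Bool} → x ∧ y ≡ true → x ≡ true × y ≡ true
∧-true {true} {true} _ = refl , refl

∧-intro : {x y : Bool} → x ≡ true → y ≡ true → x ∧ y ≡ true
∧-intro refl refl = refl

IsFilter-comap : {X Y : Set} {𝓕 : Subset X → Set} (G : Subset Y → Subset X) →
  (∀ x → G fullS x ≡ true) →
  (∀ Z Z′ → (G Z ∩S G Z′) ⊆S G (Z ∩S Z′)) →
  (∀ Z Z′ → Z ⊆S Z′ → G Z ⊆S G Z′) →
  IsFilter 𝓕 → IsFilter (𝓕 ∘ G)
IsFilter-comap G G-full G-∩ G-mono (full , ∩-closed , upward) =
  upward fullS _ (λ x _ → G-full x) full ,
  (λ Z Z′ p q → upward _ _ (G-∩ Z Z′) (∩-closed _ _ p q)) ,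
  (λ Z Z′ Z⊆Z′ → upward _ _ (G-mono Z Z′ Z⊆Z′))

IsUltrafilter-map : {X Y : Set} {𝓤 : Subset X → Set} (f : X → Y) →
  IsUltrafilter 𝓤 → IsUltrafilter (λ Z → 𝓤 (Z ∘ f))
IsUltrafilter-map f ((full , ∩-closed , upward) , proper , ultra) =
  (full , (λ _ _ → ∩-closed _ _) , (λ _ _ Z⊆Z′ → upward _ _ (Z⊆Z′ ∘ f))) ,
  proper ,
  (λ Z → ultra (Z ∘ f))

module Classical (lem : LEM) where

  holds : Set → Bool
  holds P = does (lem P)

  holds-intro : {P : Set} → P → holds P ≡ true
  holds-intro {P} p with lem P
  ... | yes _ = refl
  ... | no ¬p = ⊥-elim (¬p p)

  holds-elim : {P : Set} → holds P ≡ true → P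
  holds-elim {P} with lem P
  ... | yes p = λ _ → p
  ... | no  _ = λ ()

  module FilterProperties {X : Set} {𝓕 : Subset X → Set} (isF : IsFilter 𝓕) where

    upward : ∀ a b → a ⊆S b → 𝓕 a → 𝓕 b
    upward = proj₂ (proj₂ isF)

    everywhere : {a : Subset X} → (∀ x → a x ≡ true) → 𝓕 a
    everywhere {a} a-true = upward fullS a (λ x _ → a-true x) (proj₁ isF)

    ∩-upward : {a b c : Subset X} → 𝓕 a → 𝓕 b →
               (∀ x → a x ≡ true → b x ≡ true → c x ≡ true) → 𝓕 c
    ∩-upward {a} {b} p q a∩b⊆c =
      upward (a ∩S b) _ (λ x e → let (ax , bx) = ∧-true e in a∩b⊆c x ax bx)
             (proj₁ (proj₂ isF) a b p q)

    ⋂-closed : (m : ℕ) (S : Fin m → Subset X) → (∀ j → 𝓕 (S j)) →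
               𝓕 (λ x → holds (∀ j → S j x ≡ true))
    ⋂-closed zero    S _   = everywhere (λ _ → holds-intro (λ ()))
    ⋂-closed (suc m) S S∈𝓕 = ∩-upward (S∈𝓕 Fin.zero) (⋂-closed m (S ∘ Fin.suc) (S∈𝓕 ∘ Fin.suc))
      (λ x p q → holds-intro (λ { Fin.zero → p ; (Fin.suc j) → holds-elim q j }))

  module UltrafilterProperties {X : Set} {𝓤 : Subset X → Set} (isU : IsUltrafilter 𝓤) where
    open FilterProperties (proj₁ isU) public

    disjoint : {a b : Subset X} → 𝓤 a → 𝓤 b → (∀ x → a x ≡ true → b x ≡ true → ⊥) → ⊥
    disjoint p q a∩b=∅ = proj₁ (proj₂ isU) (∩-upward p q (λ x ax bx → ⊥-elim (a∩b=∅ x ax bx)))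

    complement : {a : Subset X} → ¬ 𝓤 a → 𝓤 (complS a)
    complement {a} a∉𝓤 with proj₂ (proj₂ isU) a
    ... | inj₁ a∈𝓤  = ⊥-elim (a∉𝓤 a∈𝓤)
    ... | inj₂ ∁a∈𝓤 = ∁a∈𝓤

    ⋃-prime : (m : ℕ) (S : Fin m → Subset X) → 𝓤 (λ x → holds (∃ λ j → S j x ≡ true)) →
              ∃ λ j → 𝓤 (S j)
    ⋃-prime m S ⋃S∈𝓤 with lem (∃ λ j → 𝓤 (S j))
    ... | yes p = p
    ... | no ¬p = ⊥-elim (disjoint ⋃S∈𝓤 (⋂-closed m (complS ∘ S) (λ j → complement (λ q → ¬p (j , q))))
      (λ x ∃j ∀j → let (j , Sjx) = holds-elim ∃j in not-true (holds-elim ∀j j) Sjx))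
      where
        not-true : {b : Bool} → not b ≡ true → b ≡ true → ⊥
        not-true {true} () _

  -- Since Ł_n is finite, every a : W → Ł_n is constant on some member of 𝓤; lim a is that value.
  module UltrafilterLimit {I : Set} {ar : I → ℕ} {n : ℕ} {F : Frame ar}
                          {𝓤 : Subset (World F) → Set} (isU : IsUltrafilter 𝓤) where
    open UltrafilterProperties isU

    fiber : Cx n F → Ł n → Subset (World F)
    fiber a k w = holds (a w ≡ k)

    lim-exists : (a : Cx n F) → ∃ λ k → 𝓤 (fiber a k)
    lim-exists a with lem (∃ λ k → 𝓤 (fiber a k))
    ... | yes p = p
    ... | no ¬p = ⊥-elim (proj₁ (proj₂ isU)
      (upward _ emptyS (λ w ∀k → ⊥-elim (not-own-fiber w (holds-elim ∀k (a w))))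
        (⋂-closed (suc n) (complS ∘ fiber a) (λ k → complement (λ q → ¬p (k , q))))))
      where
        not-own-fiber : ∀ w → not (fiber a (a w) w) ≡ true → ⊥
        not-own-fiber w rewrite holds-intro {a w ≡ a w} refl = λ ()

    lim : Cx n F → Ł n
    lim a = proj₁ (lim-exists a)

    lim-unique : (a : Cx n F) (k : Ł n) → 𝓤 (fiber a k) → lim a ≡ k
    lim-unique a k p with lim a Fin.≟ k
    ... | yes e = e
    ... | no ≢k = ⊥-elim (disjoint (proj₂ (lim-exists a)) p
                   (λ w s t → ≢k (trans (sym (holds-elim s)) (holds-elim t))))

    lim-≤ : (a : Cx n F) (t : Ł n) → 𝓤 (λ w → holds (a w ≤F t)) → lim a ≤F t
    lim-≤ a t p with toℕ (lim a) ℕ.≤? toℕ t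
    ... | yes le = le
    ... | no  ≰t = ⊥-elim (disjoint (proj₂ (lim-exists a)) p
                   (λ w s q → ≰t (subst (_≤F t) (holds-elim s) (holds-elim q))))

    limHom : Hom n F
    limHom = record
      { ap      = lim
      ; ap-cong = λ a b a≗b → sym (lim-unique b (lim a)
          (upward _ _ (λ w s → holds-intro (trans (sym (a≗b w)) (holds-elim s))) (proj₂ (lim-exists a))))
      ; ap-one  = lim-unique _ ⊤Ł (everywhere (λ _ → holds-intro refl))
      ; ap-neg  = λ a → lim-unique _ _
          (upward _ _ (λ w s → holds-intro (cong ¬Ł (holds-elim s))) (proj₂ (lim-exists a)))
      ; ap-imp  = λ a b → lim-unique _ _ (∩-upward (proj₂ (lim-exists a)) (proj₂ (lim-exists b))
          (λ w s t → holds-intro (cong₂ _⇒Ł_ (holds-elim s) (holds-elim t))))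
      }

module _ {n : ℕ} where

  IsInf-maxŁ-threshold : {S : Set} {P : S → Set} {k : ℕ} {g : S → Fin k → Ł n} {x t : Ł n} →
    0 ℕ.< toℕ t → IsInf P (λ s → maxŁ k (g s)) x → IsInf P (λ s → maxŁ k (threshold t ∘ g s)) (threshold t x)
  IsInf-maxŁ-threshold {S} {P} {k} {g} {x} {t} t>0 (lb , glb) = lb′ , glb′
    where
      ≤thresholds : ∀ s {z} → t ≤F z → z ≤F maxŁ k (g s) → ⊤Ł ≤F maxŁ k (threshold t ∘ g s)
      ≤thresholds s t≤z z≤max with maxŁ-≥-witness k (g s) t>0 (≤-trans t≤z z≤max)
      ... | ℓ , t≤gℓ = subst (_≤F maxŁ k (threshold t ∘ g s)) (threshold-≤ t≤gℓ)
                             (maxŁ-ub k (threshold t ∘ g s) ℓ)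

      lb′ : ∀ s → P s → threshold t x ≤F maxŁ k (threshold t ∘ g s)
      lb′ s p with toℕ t ℕ.≤? toℕ x
      ... | yes t≤x = ≤-trans (≤⊤Ł (threshold t x)) (≤thresholds s t≤x (lb s p))
      ... | no  t≰x = subst (_≤F maxŁ k (threshold t ∘ g s)) (sym (threshold-≰ t≰x)) z≤n

      glb′ : ∀ y → (∀ s → P s → y ≤F maxŁ k (threshold t ∘ g s)) → y ≤F threshold t x
      glb′ y y-lb with toℕ y ℕ.≟ 0
      ... | yes y≡0 = subst (ℕ._≤ toℕ (threshold t x)) (sym y≡0) z≤n
      ... | no  y≢0 = subst (y ≤F_) (sym (threshold-≤ (glb t t-lb))) (≤⊤Ł y)
        where
          t-lb : ∀ s → P s → t ≤F maxŁ k (g s)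
          t-lb s p with maxŁ-≥-witness k (threshold t ∘ g s) (ℕ.n≢0⇒n>0 y≢0) (y-lb s p)
          ... | ℓ , y≤ = ≤-trans (threshold-pos (<-≤-trans (ℕ.n≢0⇒n>0 y≢0) y≤)) (maxŁ-ub k (g s) ℓ)

IsNabla-threshold : {I : Set} {ar : I → ℕ} {n : ℕ} (F : Frame ar) (i : I) {a : Fin (ar i) → Cx n F} {b : Cx n F}
  {t : Ł n} → 0 ℕ.< toℕ t → IsNabla n F i a b → IsNabla n F i (λ ℓ → threshold t ∘ a ℓ) (threshold t ∘ b)
IsNabla-threshold {ar = ar} F i {a} t>0 b≡∇a w =
  IsInf-maxŁ-threshold {k = ar i} {g = λ ws ℓ → a ℓ (ws ℓ)} t>0 (b≡∇a w)

module HomFilter (lem : LEM) {I : Set} {ar : I → ℕ} {n : ℕ} {F : Frame ar}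
                 (1≤n : 1 ℕ.≤ n) (u : Hom n F) where
  open Classical lem
  open HomProperties u

  χ : Bool → Ł n
  χ true  = ⊤Ł
  χ false = ⊥Ł

  -- u restricted to the idempotents of F₊ₙ, read as an ultrafilter of sets of worlds
  homFilter : Subset (World F) → Set
  homFilter X = ap u (χ ∘ X) ≡ ⊤Ł

  χ-∧ : (x y : Bool) → χ x ⊙ χ y ≡ χ (x ∧ y)
  χ-∧ true  true  = pow-⊤Ł 1
  χ-∧ true  false = ⊙-⊥Ł ⊤Ł
  χ-∧ false y     = ⊥Ł-⊙ (χ y)

  χ-mono : {x y : Bool} → (x ≡ true → y ≡ true) → χ x ≤F χ y
  χ-mono {false}         _     = z≤n
  χ-mono {true}  {true}  _     = ≤-refl
  χ-mono {true}  {false} x⇒y  with x⇒y refl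
  ... | ()

  homFilter-isFilter : IsFilter homFilter
  homFilter-isFilter = ap-one u , ∩-closed , upward
    where
      ∩-closed : ∀ X Y → homFilter X → homFilter Y → homFilter (X ∩S Y)
      ∩-closed X Y X∈ Y∈ = begin
        ap u (χ ∘ (X ∩S Y))                      ≡⟨ ap-cong u _ _ (λ w → sym (χ-∧ (X w) (Y w))) ⟩
        ap u (λ w → χ (X w) ⊙ χ (Y w))           ≡⟨ ap-⊙ (χ ∘ X) (χ ∘ Y) ⟩
        ap u (χ ∘ X) ⊙ ap u (χ ∘ Y)              ≡⟨ cong₂ _⊙_ X∈ Y∈ ⟩
        ⊤Ł ⊙ ⊤Ł                                  ≡⟨ pow-⊤Ł 1 ⟩
        ⊤Ł                                       ∎
        where open ≡-Reasoning

      upward : ∀ X Y → X ⊆S Y → homFilter X → homFilter Y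
      upward X Y X⊆Y X∈ = ⊤Ł≤⇒≡⊤Ł (subst (_≤F ap u (χ ∘ Y)) X∈ (ap-≤ (λ w → χ-mono (X⊆Y w))))

  homFilter-proper : ¬ homFilter emptyS
  homFilter-proper ∅∈ = ⊤Ł≢⊥Ł 1≤n (trans (sym ∅∈) ap-⊥Ł)

  homFilter-⊤Ł : (a : Cx n F) → ap u a ≡ ⊤Ł → homFilter (λ w → holds (a w ≡ ⊤Ł))
  homFilter-⊤Ł a ua≡⊤ = begin
    ap u (λ w → χ (holds (a w ≡ ⊤Ł)))   ≡⟨ ap-cong u _ _ (λ w → χ-holds-⊤Ł (a w)) ⟩
    ap u (pow n ∘ a)                    ≡⟨ ap-pow n a ⟩
    pow n (ap u a)                      ≡⟨ cong (pow n) ua≡⊤ ⟩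
    pow n ⊤Ł                            ≡⟨ pow-⊤Ł n ⟩
    ⊤Ł                                  ∎
    where
      open ≡-Reasoning
      χ-holds-⊤Ł : (x : Ł n) → χ (holds (x ≡ ⊤Ł)) ≡ pow n x
      χ-holds-⊤Ł x with lem (x ≡ ⊤Ł)
      ... | yes x≡⊤ = sym (trans (cong (pow n) x≡⊤) (pow-⊤Ł n))
      ... | no  x≢⊤ = sym (pow-n-≢⊤Ł x≢⊤)

module CanonicalNabla (lem : LEM) (ultrafilterLemma : UltrafilterLemma)
                      {I : Set} {ar : I → ℕ} {n : ℕ} {F : Frame ar} (1≤n : 1 ℕ.≤ n)
                      (i : I) {a : Fin (ar i) → Cx n F} {b : Cx n F} (b≡∇a : IsNabla n F i a b)
                      (u : Hom n F) where
  open Classical lem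
  open HomFilter lem 1≤n u

  private
    k : ℕ
    k = ar i

    t : Ł n
    t = ap u b

  -- The threshold map at t turns ∇a = b into a {0,1}-valued instance that u sends to 1.
  CeR-lower : (vs : Fin k → Hom n F) → CeR n F i u vs → t ≤F maxŁ k (λ ℓ → ap (vs ℓ) (a ℓ))
  CeR-lower vs u-R-vs with toℕ t ℕ.≟ 0
  ... | yes t≡0 = subst (ℕ._≤ _) (sym t≡0) z≤n
  ... | no  t≢0 with maxŁ-≥-witness k (λ ℓ → threshold t (ap (vs ℓ) (a ℓ))) (0<toℕ⊤Ł 1≤n) (ℕ.≤-reflexive (cong toℕ (sym max≡⊤)))
    where
      max≡⊤ : maxŁ k (λ ℓ → threshold t (ap (vs ℓ) (a ℓ))) ≡ ⊤Ł
      max≡⊤ = trans (maxŁ-cong k (λ ℓ → sym (HomProperties.ap-threshold (vs ℓ) 1≤n t (a ℓ))))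
        (u-R-vs (λ ℓ → threshold t ∘ a ℓ) (threshold t ∘ b)
                (IsNabla-threshold F i {a} (ℕ.n≢0⇒n>0 t≢0) b≡∇a)
                (trans (HomProperties.ap-threshold u 1≤n t b) (threshold-≤ {t = t} ≤-refl)))
  ... | ℓ , ⊤≤ = ≤-trans (threshold-pos (<-≤-trans (0<toℕ⊤Ł 1≤n) ⊤≤)) (maxŁ-ub k (λ ℓ → ap (vs ℓ) (a ℓ)) ℓ)

  -- For t < 1 the successors come from an ultrafilter of k-tuples of worlds extending
  -- {Z | □Z ∈ homFilter}, where □ only looks at successor tuples lying pointwise below t.
  module BelowWitness (t<⊤ : toℕ t ℕ.< n) where

    Tuple : Set
    Tuple = Fin k → World F

    Below : Tuple → Set
    Below ws = ∀ ℓ → a ℓ (ws ℓ) ≤F t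

    □ : Subset Tuple → Subset (World F)
    □ Z w = holds (∀ ws → R F i w ws → Below ws → Z ws ≡ true)

    □-isFilter : IsFilter (homFilter ∘ □)
    □-isFilter = IsFilter-comap □
      (λ _ → holds-intro (λ _ _ _ → refl))
      (λ Z Z′ w e → let (Zw , Z′w) = ∧-true e in
         holds-intro (λ ws r ≤t → ∧-intro (holds-elim Zw ws r ≤t) (holds-elim Z′w ws r ≤t)))
      (λ Z Z′ Z⊆Z′ w e → holds-intro (λ ws r ≤t → Z⊆Z′ ws (holds-elim e ws r ≤t)))
      homFilter-isFilter

    open FilterProperties homFilter-isFilter using (∩-upward)

    b≤t∈homFilter : homFilter (λ w → holds (b w ≤F t))
    b≤t∈homFilter = FilterProperties.upward homFilter-isFilter _ (λ w → holds (b w ≤F t))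
      (λ w e → holds-intro (⇒Ł≡⊤Ł⇒≤ (holds-elim e)))
      (homFilter-⊤Ł (λ w → b w ⇒Ł t)
        (trans (ap-imp u b (const t)) (trans (cong (t ⇒Ł_) (HomProperties.ap-const u 1≤n t)) (≤⇒⇒Ł≡⊤Ł {x = t} {y = t} ≤-refl))))

    -- Where b w ≤ t, some successor tuple lies below t: otherwise t + 1/n would be a lower bound.
    □-proper : ¬ homFilter (□ emptyS)
    □-proper □∅∈ = homFilter-proper (∩-upward {c = emptyS} □∅∈ b≤t∈homFilter
      (λ w none b≤t → ⊥-elim (ℕ.<⇒≱ (subst (ℕ._≤ toℕ (b w)) (toℕ-fromℕ< t<⊤′) (t⁺≤b w (holds-elim none)))
                                     (holds-elim b≤t))))
      where
        t<⊤′ : suc (toℕ t) ℕ.< suc n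
        t<⊤′ = s≤s t<⊤

        t⁺ : Ł n
        t⁺ = fromℕ< t<⊤′

        t⁺≤b : ∀ w → (∀ ws → R F i w ws → Below ws → false ≡ true) → t⁺ ≤F b w
        t⁺≤b w none = proj₂ (b≡∇a w) t⁺ λ ws r →
          let (ℓ , a≰t) = ¬∀⟶∃¬ k (λ ℓ → a ℓ (ws ℓ) ≤F t) (λ ℓ → a ℓ (ws ℓ) Fin.≤? t) (λ ≤t → contradiction (none ws r ≤t) λ ())
          in ≤-trans (subst (ℕ._≤ toℕ (a ℓ (ws ℓ))) (sym (toℕ-fromℕ< t<⊤′)) (ℕ.≰⇒> a≰t))
                     (maxŁ-ub k (λ ℓ → a ℓ (ws ℓ)) ℓ)

    private
      extension = ultrafilterLemma Tuple (homFilter ∘ □) □-isFilter □-proper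

    𝔘 : Subset Tuple → Set
    𝔘 = proj₁ extension

    𝔘-isUltrafilter : IsUltrafilter 𝔘
    𝔘-isUltrafilter = proj₁ (proj₂ extension)

    □⁻¹-⊆-𝔘 : ∀ Z → homFilter (□ Z) → 𝔘 Z
    □⁻¹-⊆-𝔘 = proj₂ (proj₂ extension)

    vs : Fin k → Hom n F
    vs ℓ = UltrafilterLimit.limHom (IsUltrafilter-map (λ ws → ws ℓ) 𝔘-isUltrafilter)

    vs-below : ∀ ℓ → ap (vs ℓ) (a ℓ) ≤F t
    vs-below ℓ = UltrafilterLimit.lim-≤ (IsUltrafilter-map (λ ws → ws ℓ) 𝔘-isUltrafilter) (a ℓ) t
      (□⁻¹-⊆-𝔘 _ (FilterProperties.everywhere homFilter-isFilter
        (λ w → holds-intro (λ ws r ≤t → holds-intro (≤t ℓ)))))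

    u-R-vs : CeR n F i u vs
    u-R-vs a′ b′ b′≡∇a′ ub′≡⊤ = ⊤Ł≤⇒≡⊤Ł (≤-trans (ℕ.≤-reflexive (cong toℕ (sym vℓ-a′ℓ≡⊤)))
                                            (maxŁ-ub k (λ ℓ → ap (vs ℓ) (a′ ℓ)) ℓ₀))
      where
        a′-top : Fin k → Subset Tuple
        a′-top ℓ ws = holds (a′ ℓ (ws ℓ) ≡ ⊤Ł)

        some-a′-top∈𝔘 : 𝔘 (λ ws → holds (∃ λ ℓ → a′-top ℓ ws ≡ true))
        some-a′-top∈𝔘 = □⁻¹-⊆-𝔘 _ (FilterProperties.upward homFilter-isFilter _ _
          (λ w b′w≡⊤ → holds-intro (λ ws r _ →
            let max≡⊤ = ⊤Ł≤⇒≡⊤Ł (subst (_≤F maxŁ k (λ ℓ → a′ ℓ (ws ℓ))) (holds-elim b′w≡⊤) (proj₁ (b′≡∇a′ w) ws r))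
                (ℓ , ⊤≤) = maxŁ-≥-witness k (λ ℓ → a′ ℓ (ws ℓ)) (0<toℕ⊤Ł 1≤n) (ℕ.≤-reflexive (cong toℕ (sym max≡⊤)))
            in holds-intro (ℓ , holds-intro (⊤Ł≤⇒≡⊤Ł ⊤≤))))
          (homFilter-⊤Ł b′ ub′≡⊤))

        ℓ₀ : Fin k
        ℓ₀ = proj₁ (UltrafilterProperties.⋃-prime 𝔘-isUltrafilter k a′-top some-a′-top∈𝔘)

        vℓ-a′ℓ≡⊤ : ap (vs ℓ₀) (a′ ℓ₀) ≡ ⊤Ł
        vℓ-a′ℓ≡⊤ = UltrafilterLimit.lim-unique (IsUltrafilter-map (λ ws → ws ℓ₀) 𝔘-isUltrafilter) (a′ ℓ₀) ⊤Ł
          (proj₂ (UltrafilterProperties.⋃-prime 𝔘-isUltrafilter k a′-top some-a′-top∈𝔘))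

  ∇-canonical : IsInf (CeR n F i u) (λ vs → maxŁ k (λ ℓ → ap (vs ℓ) (a ℓ))) t
  ∇-canonical = CeR-lower , glb
    where
      glb : ∀ y → (∀ vs → CeR n F i u vs → y ≤F maxŁ k (λ ℓ → ap (vs ℓ) (a ℓ))) → y ≤F t
      glb y y-lb with toℕ t ℕ.<? n
      ... | yes t<⊤ = let open BelowWitness t<⊤ in
                      ≤-trans (y-lb vs u-R-vs) (maxŁ-lub k (λ ℓ → ap (vs ℓ) (a ℓ)) vs-below)
      ... | no  t≮⊤ = subst (y ≤F_) (sym (toℕ≡n⇒≡⊤Ł (ℕ.≤-antisym (toℕ≤n t) (ℕ.≮⇒≥ t≮⊤)))) (≤⊤Ł y)

proposition3p16 : LEM → UltrafilterLemma →
    {I : Set} (ar : I → ℕ) (n : ℕ) → 1 ≤ n →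
    (F : Frame ar) (V : World F → ℕ → Ł n)
    (S : Form ar → World F → Ł n) → IsValuation n F V S →
    (Se : Form ar → Hom n F → Ł n) → IsValuation n (Ce n F) (Vale n F V) Se →
    (u : Hom n F) (φ : Form ar) → Se φ u ≡ ap u (λ w → S φ w)
proposition3p16 lem ultrafilterLemma ar n 1≤n F V S S-val Se Se-val = truth
  where
    open IsValuation
    open ≡-Reasoning
    truth : (u : Hom n F) (φ : Form ar) → Se φ u ≡ ap u (λ w → S φ w)
    truth u (var p) = trans (sem-var Se-val p u) (ap-cong u _ _ (λ w → sym (sem-var S-val p w)))
    truth u one = begin
      Se one u                ≡⟨ sem-one Se-val u ⟩
      ⊤Ł                      ≡⟨ ap-one u ⟨
      ap u (λ _ → ⊤Ł)         ≡⟨ ap-cong u _ _ (λ w → sym (sem-one S-val w)) ⟩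
      ap u (λ w → S one w)    ∎
    truth u (neg φ) = begin
      Se (neg φ) u                  ≡⟨ sem-neg Se-val φ u ⟩
      ¬Ł (Se φ u)                   ≡⟨ cong ¬Ł (truth u φ) ⟩
      ¬Ł (ap u (λ w → S φ w))       ≡⟨ ap-neg u (λ w → S φ w) ⟨
      ap u (λ w → ¬Ł (S φ w))       ≡⟨ ap-cong u _ _ (λ w → sym (sem-neg S-val φ w)) ⟩
      ap u (λ w → S (neg φ) w)      ∎
    truth u (imp φ ψ) = begin
      Se (imp φ ψ) u                                 ≡⟨ sem-imp Se-val φ ψ u ⟩
      Se φ u ⇒Ł Se ψ u                               ≡⟨ cong₂ _⇒Ł_ (truth u φ) (truth u ψ) ⟩
      ap u (λ w → S φ w) ⇒Ł ap u (λ w → S ψ w)       ≡⟨ ap-imp u (λ w → S φ w) (λ w → S ψ w) ⟨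
      ap u (λ w → S φ w ⇒Ł S ψ w)                    ≡⟨ ap-cong u _ _ (λ w → sym (sem-imp S-val φ ψ w)) ⟩
      ap u (λ w → S (imp φ ψ) w)                     ∎
    truth u (nab i φs) = IsInf-unique
      (IsInf-cong (λ vs → maxŁ-cong (ar i) (λ ℓ → truth (vs ℓ) (φs ℓ))) (sem-nab Se-val i φs u))
      (CanonicalNabla.∇-canonical lem ultrafilterLemma 1≤n i (sem-nab S-val i φs) u)
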